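{- For every $n\ge 1$ and every formula $\varphi$: if the sequent $\Rightarrow\{1,\dots,n\}:\varphi$ is derivable in $\mathbf{G}(\mathsf{FBInqBQ})$, then $\varphi\in\mathsf{InqBQ}_n$.
   Context: Language: countably infinite set $\mathsf{Var}$ of variables, countably infinite set $\mathsf{Pred}$ of predicate symbols with arities (no identity, constants, function symbols). Formulas: $\varphi ::= P(x_1,\dots,x_m)\mid \bot\mid \varphi\to\varphi\mid\varphi\wedge\varphi\mid \varphi\veebar\varphi\mid \forall x\varphi\mid \bar\exists x\varphi$ ($\veebar$ inquisitive disjunction, $\bar\exists$ inquisitive existential). $\varphi[z/x]$ is capture-avoiding substitution. Semantics: a relational information model $\mathfrak M=(W,D,\mathfrak I)$ has nonempty $W$, nonempty $D$, $\mathfrak I(P,w)\subseteq D^m$; for states $s\subseteq W$ and $g:\mathsf{Var}\to D$: $s\Vdash_g P(\bar x)$ iff $g(\bar x)\in\mathfrak I(P,w)$ for all $w\in s$; $s\Vdash_g\bot$ iff $s=\varnothing$; $\wedge$ pointwise; $s\Vdash_g\varphi\to\psi$ iff every $t\subseteq s$ supporting $\varphi$ supports $\psi$; $s\Vdash_g\varphi\veebar\psi$ iff $s\Vdash_g\varphi$ or $s\Vdash_g\psi$; $\forall x$ / $\bar\exists x$: for all / some $d\in D$, $s\Vdash_{g[x\mapsto d]}\varphi$. $\mathsf{InqBQ}_n$: formulas supported at all states under all assignments in all models with $|W|\le n$. Calculus $\mathbf{G}(\mathsf{FBInqBQ})$: a label is a nonempty finite subset of $\omega$; a labelled formula is $X:\varphi$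 with $X$ a label; a sequent $\Gamma\Rightarrow\Delta$ is a pair of finite multisets of labelled formulas. $X,Y$ range over labels. Initial sequents: $(\mathtt{id})$ $X:P(\bar x),\Gamma\Rightarrow\Delta,Y:P(\bar x)$ whenever $X\supseteq Y$; $(\bot\Rightarrow)$ $X:\bot,\Gamma\Rightarrow\Delta$. Rules (premises / conclusion): $(\Rightarrow\mathtt{at})$: $\Gamma\Rightarrow\Delta,\{k\}:P(\bar x)$ for every $k\in X$ / $\Gamma\Rightarrow\Delta,X:P(\bar x)$. $(\Rightarrow\wedge)$: $\Gamma\Rightarrow\Delta,X:\varphi$ and $\Gamma\Rightarrow\Delta,X:\psi$ / $\Gamma\Rightarrow\Delta,X:\varphi\wedge\psi$. $(\wedge\Rightarrow)$: $X:\varphi,X:\psi,\Gamma\Rightarrow\Delta$ / $X:\varphi\wedge\psi,\Gamma\Rightarrow\Delta$. $(\Rightarrow\veebar)$: $\Gamma\Rightarrow\Delta,X:\varphi,X:\psi$ / $\Gamma\Rightarrow\Delta,X:\varphi\veebar\psi$. $(\veebar\Rightarrow)$: $X:\varphi,\Gamma\Rightarrow\Delta$ and $X:\psi,\Gamma\Rightarrow\Delta$ / $X:\varphi\veebar\psi,\Gamma\Rightarrow\Delta$. $(\Rightarrow\to)$: $Y:\varphi,\Gamma\Rightarrow\Delta,Y:\psi$ for every label $Y\subseteq X$ / $\Gamma\Rightarrow\Delta,X:\varphi\to\psi$. $(\to\Rightarrow)$, for a label $Y\subseteq X$: $X:\varphi\to\psi,\Gamma\Rightarrow\Delta,Y:\varphi$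 and $Y:\psi,X:\varphi\to\psi,\Gamma\Rightarrow\Delta$ / $X:\varphi\to\psi,\Gamma\Rightarrow\Delta$. $(\Rightarrow\forall)$: $\Gamma\Rightarrow\Delta,X:\varphi[z/x]$ / $\Gamma\Rightarrow\Delta,X:\forall x\varphi$, with $z$ not occurring in the conclusion. $(\forall\Rightarrow)$: $X:\varphi[y/x],X:\forall x\varphi,\Gamma\Rightarrow\Delta$ / $X:\forall x\varphi,\Gamma\Rightarrow\Delta$ ($y$ arbitrary). $(\Rightarrow\bar\exists)$: $\Gamma\Rightarrow\Delta,X:\bar\exists x\varphi,X:\varphi[y/x]$ / $\Gamma\Rightarrow\Delta,X:\bar\exists x\varphi$ ($y$ arbitrary). $(\bar\exists\Rightarrow)$: $X:\varphi[z/x],\Gamma\Rightarrow\Delta$ / $X:\bar\exists x\varphi,\Gamma\Rightarrow\Delta$, with $z$ not occurring in the conclusion. A derivation is a finite tree of sequents built from initial sequents by these rules; a sequent is derivable if it is the root of a derivation. -}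

module Defs where

open import Level using (Level; 0ℓ; Lift; lift) renaming (suc to lsuc)
open import Data.Nat using (ℕ; zero; suc; _≤_; _<_; _⊔_; _≡ᵇ_)
open import Data.Bool.ListAction using (any)
open import Data.Bool using (Bool; true; false; if_then_else_; not; _∧_)
open import Data.Product using (Σ; _×_; _,_)
open import Data.Sum using (_⊎_)
open import Data.Empty using (⊥)
open import Data.Fin using (Fin)
open import Data.List using (List; []; _∷_; _++_; map; filter; foldr; concatMap)
open import Data.List.Relation.Unary.All using (All)
open import Data.List.Relation.Unary.AllPairs using (AllPairs)
open import Data.List.Membership.Propositional using (_∈_; _∉_)
open import Data.List.Relation.Binary.Permutation.Propositional using (_↭_)
open import Data.Vec using (Vec)
import Data.Vec as Vec
open import Relation.Nullary using (¬_)
open import Relation.Binary.PropositionalEquality using (_≡_; _≢_)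
open import Function.Bundles using (_↣_)

Var : Set
Var = ℕ

-- A predicate symbol is a pair (name p, arity m): countably many of each arity.
-- atom p m xs  is  P(x₁,…,x_m)  for the symbol (p , m).
infixr 6 _⇒'_
infixr 7 _∧'_ _⩒_
data Formula : Set where
  atom : (p m : ℕ) → Vec Var m → Formula
  ⊥'   : Formula
  _⇒'_ : Formula → Formula → Formula
  _∧'_ : Formula → Formula → Formula
  _⩒_  : Formula → Formula → Formula
  ∀'   : Var → Formula → Formula
  ∃̄    : Var → Formula → Formula

FV : Formula → List Var
FV (atom p m xs) = Vec.toList xs
FV ⊥' = []
FV (φ ⇒' ψ) = FV φ ++ FV ψ
FV (φ ∧' ψ) = FV φ ++ FV ψ
FV (φ ⩒ ψ) = FV φ ++ FV ψ
FV (∀' x φ) = filter (λ u → Relation.Nullary.¬? (u Data.Nat.≟ x)) (FV φ)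
FV (∃̄ x φ) = filter (λ u → Relation.Nullary.¬? (u Data.Nat.≟ x)) (FV φ)

vars : Formula → List Var
vars (atom p m xs) = Vec.toList xs
vars ⊥' = []
vars (φ ⇒' ψ) = vars φ ++ vars ψ
vars (φ ∧' ψ) = vars φ ++ vars ψ
vars (φ ⩒ ψ) = vars φ ++ vars ψ
vars (∀' x φ) = x ∷ vars φ
vars (∃̄ x φ) = x ∷ vars φ

_[_↦_] : (Var → Var) → Var → Var → (Var → Var)
(σ [ y ↦ w ]) u = if u ≡ᵇ y then w else σ u

-- Choice of the bound variable when pushing a renaming σ under a binder y:
-- keep y unless some free variable u ≠ y of the body is sent to y by σ
-- (capture), in which case use a variable larger than all σ u, u free.
binder : (Var → Var) → Var → Formula → Var
binder σ y φ =
  if any (λ u → not (u ≡ᵇ y) ∧ (σ u ≡ᵇ y)) (FV φ)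
  then suc (foldr _⊔_ y (map σ (FV φ)))
  else y

rename : (Var → Var) → Formula → Formula
rename σ (atom p m xs) = atom p m (Vec.map σ xs)
rename σ ⊥' = ⊥'
rename σ (φ ⇒' ψ) = rename σ φ ⇒' rename σ ψ
rename σ (φ ∧' ψ) = rename σ φ ∧' rename σ ψ
rename σ (φ ⩒ ψ) = rename σ φ ⩒ rename σ ψ
rename σ (∀' y φ) = ∀' (binder σ y φ) (rename (σ [ y ↦ binder σ y φ ]) φ)
rename σ (∃̄ y φ) = ∃̄ (binder σ y φ) (rename (σ [ y ↦ binder σ y φ ]) φ)

_[_/_] : Formula → Var → Var → Formula
φ [ z / x ] = rename ((λ u → u) [ x ↦ z ]) φ

record Model : Set₁ where
  field
    W  : Set
    D  : Set
    w₀ : W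
    d₀ : D
    𝔍  : (p m : ℕ) → W → Vec D m → Set

module _ (M : Model) where
  open Model M

  State : Set₁
  State = W → Set

  _⊆ₛ_ : State → State → Set
  t ⊆ₛ s = ∀ w → t w → s w

  _[_≔_] : (Var → D) → Var → D → (Var → D)
  (g [ x ≔ d ]) u = if u ≡ᵇ x then d else g u

  _⊩[_]_ : State → (Var → D) → Formula → Set₁
  s ⊩[ g ] atom p m xs = Lift (lsuc 0ℓ) (∀ w → s w → 𝔍 p m w (Vec.map g xs))
  s ⊩[ g ] ⊥' = Lift (lsuc 0ℓ) (∀ w → ¬ s w)
  s ⊩[ g ] (φ ⇒' ψ) = ∀ (t : State) → t ⊆ₛ s → t ⊩[ g ] φ → t ⊩[ g ] ψ
  s ⊩[ g ] (φ ∧' ψ) = s ⊩[ g ] φ × s ⊩[ g ] ψ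
  s ⊩[ g ] (φ ⩒ ψ) = s ⊩[ g ] φ ⊎ s ⊩[ g ] ψ
  s ⊩[ g ] ∀' x φ = ∀ (d : D) → s ⊩[ g [ x ≔ d ] ] φ
  s ⊩[ g ] ∃̄ x φ = Σ D (λ d → s ⊩[ g [ x ≔ d ] ] φ)

-- InqBQ_n : supported at all states under all assignments in all models
-- with |W| ≤ n (an injection of W into Fin n).
InqBQ : ℕ → Formula → Set₁
InqBQ n φ = ∀ (M : Model) → (Model.W M ↣ Fin n) →
  ∀ (s : State M) (g : Var → Model.D M) → _⊩[_]_ M s g φ

-- Labels: nonempty finite subsets of ω, canonically represented as
-- strictly increasing nonempty lists.

record Label : Set where
  constructor mkLabel
  field
    elems    : List ℕ
    strict   : AllPairs _<_ elems
    nonempty : elems ≢ []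
open Label public

_∈L_ : ℕ → Label → Set
k ∈L X = k ∈ elems X

_⊆L_ : Label → Label → Set
Y ⊆L X = ∀ {k} → k ∈L Y → k ∈L X

singleton : ℕ → Label
singleton k = mkLabel (k ∷ []) (All.[] AllPairs.∷ AllPairs.[]) (λ ())
  where
  import Data.List.Relation.Unary.All as All
  import Data.List.Relation.Unary.AllPairs as AllPairs

LFormula : Set
LFormula = Label × Formula

_∶_ : Label → Formula → LFormula
X ∶ φ = X , φ
infix 5 _∶_

lvars : List LFormula → List Var
lvars = concatMap (λ { (X , φ) → vars φ })

-- The calculus G(FBInqBQ).  Sequents are pairs of lists taken up to
-- permutation (= finite multisets), via the constructor `perm`.
-- Principal formulas are written at the head of the lists.

infix 3 _⟹_
data _⟹_ : List LFormula → List LFormula → Set where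
  perm : ∀ {Γ Γ' Δ Δ'} → Γ ↭ Γ' → Δ ↭ Δ' → Γ ⟹ Δ → Γ' ⟹ Δ'
  id   : ∀ {X Y p m xs Γ Δ} → Y ⊆L X →
         (X ∶ atom p m xs) ∷ Γ ⟹ (Y ∶ atom p m xs) ∷ Δ
  ⊥⇒   : ∀ {X Γ Δ} → (X ∶ ⊥') ∷ Γ ⟹ Δ
  ⇒at  : ∀ {X p m xs Γ Δ} →
         (∀ k → k ∈L X → Γ ⟹ (singleton k ∶ atom p m xs) ∷ Δ) →
         Γ ⟹ (X ∶ atom p m xs) ∷ Δ
  ⇒∧   : ∀ {X φ ψ Γ Δ} → Γ ⟹ (X ∶ φ) ∷ Δ → Γ ⟹ (X ∶ ψ) ∷ Δ →
         Γ ⟹ (X ∶ φ ∧' ψ) ∷ Δ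
  ∧⇒   : ∀ {X φ ψ Γ Δ} → (X ∶ φ) ∷ (X ∶ ψ) ∷ Γ ⟹ Δ →
         (X ∶ φ ∧' ψ) ∷ Γ ⟹ Δ
  ⇒⩒   : ∀ {X φ ψ Γ Δ} → Γ ⟹ (X ∶ φ) ∷ (X ∶ ψ) ∷ Δ →
         Γ ⟹ (X ∶ φ ⩒ ψ) ∷ Δ
  ⩒⇒   : ∀ {X φ ψ Γ Δ} → (X ∶ φ) ∷ Γ ⟹ Δ → (X ∶ ψ) ∷ Γ ⟹ Δ →
         (X ∶ φ ⩒ ψ) ∷ Γ ⟹ Δ
  ⇒→   : ∀ {X φ ψ Γ Δ} →
         (∀ (Y : Label) → Y ⊆L X → (Y ∶ φ) ∷ Γ ⟹ (Y ∶ ψ) ∷ Δ) →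
         Γ ⟹ (X ∶ φ ⇒' ψ) ∷ Δ
  →⇒   : ∀ {X Y φ ψ Γ Δ} → Y ⊆L X →
         (X ∶ φ ⇒' ψ) ∷ Γ ⟹ (Y ∶ φ) ∷ Δ →
         (Y ∶ ψ) ∷ (X ∶ φ ⇒' ψ) ∷ Γ ⟹ Δ →
         (X ∶ φ ⇒' ψ) ∷ Γ ⟹ Δ
  ⇒∀   : ∀ {X x z φ Γ Δ} →
         z ∉ lvars Γ → z ∉ lvars ((X ∶ ∀' x φ) ∷ Δ) →
         Γ ⟹ (X ∶ φ [ z / x ]) ∷ Δ →
         Γ ⟹ (X ∶ ∀' x φ) ∷ Δ
  ∀⇒   : ∀ {X x y φ Γ Δ} →
         (X ∶ φ [ y / x ]) ∷ (X ∶ ∀' x φ) ∷ Γ ⟹ Δ →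
         (X ∶ ∀' x φ) ∷ Γ ⟹ Δ
  ⇒∃̄   : ∀ {X x y φ Γ Δ} →
         Γ ⟹ (X ∶ ∃̄ x φ) ∷ (X ∶ φ [ y / x ]) ∷ Δ →
         Γ ⟹ (X ∶ ∃̄ x φ) ∷ Δ
  ∃̄⇒   : ∀ {X x z φ Γ Δ} →
         z ∉ lvars ((X ∶ ∃̄ x φ) ∷ Γ) → z ∉ lvars Δ →
         (X ∶ φ [ z / x ]) ∷ Γ ⟹ Δ →
         (X ∶ ∃̄ x φ) ∷ Γ ⟹ Δ

{-# OPTIONS --safe #-}
module Submission where

-- Fix a model and an enumeration h : ℕ → W, and read a label X as the state
-- ⟦ X ⟧ = {h k | k ∈ X}.  Every rule then preserves "if all antecedents are
-- supported, some succedent is", under every assignment.  Two rules carry the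
-- content of the bounded semantics: atoms are supported pointwise (⇒at), and
-- every substate of ⟦ X ⟧ is empty or of the form ⟦ Y ⟧ for a label Y ⊆ X
-- (⇒→).  When |W| ≤ n, h can enumerate W by 1, …, n, so ⟦ {1, …, n} ⟧ is all
-- of W and persistence transfers support to every state.

open import Defs
open import Level using (0ℓ; Lift; lift; lower) renaming (suc to lsuc; _⊔_ to _⊔ℓ_)
open import Axiom.ExcludedMiddle using (ExcludedMiddle)
open import Data.Nat using (ℕ; suc; _≤_; _<_; _⊔_; _≡ᵇ_; _≟_; s≤s; z≤n)
open import Data.Nat.Properties using (m≤m⊔n; m≤n⊔m; ≤-trans; <⇒≢; ≡⇒≡ᵇ; suc-injective)
open import Data.Bool using (Bool; true; false; T; if_then_else_; not; _∧_)
open import Data.Bool.Properties using (if-float; if-cong₂; T-∧; T-not-≡)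
open import Data.Bool.ListAction using (any)
open import Data.Product as Product using (Σ; _×_; _,_; proj₁; proj₂)
open import Data.Sum as Sum using (_⊎_; inj₁; inj₂)
open import Data.Empty using (⊥-elim)
open import Data.Fin using (Fin; toℕ)
open import Data.Fin.Properties using (toℕ-injective; toℕ<n)
open import Data.List using (List; []; _∷_; _++_; map; filter; foldr)
open import Data.List.Relation.Unary.All using (All; []; _∷_)
open import Data.List.Relation.Unary.Any as Any using (Any; here; there)
open import Data.List.Relation.Unary.Any.Properties using (any⁺; ¬Any[])
open import Data.List.Relation.Unary.AllPairs using (AllPairs)
import Data.List.Relation.Unary.AllPairs.Properties as AllPairs
open import Data.List.Membership.Propositional using (_∈_; _∉_; lose)
open import Data.List.Membership.Propositional.Properties
  using (∈-filter⁺; ∈-filter⁻; ∈-++⁺ˡ; ∈-++⁺ʳ)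
open import Data.List.Relation.Binary.Subset.Propositional using (_⊆_)
open import Data.List.Relation.Binary.Subset.Propositional.Properties using (++⁺)
open import Data.List.Relation.Binary.Permutation.Propositional using (↭-sym)
open import Data.List.Relation.Binary.Permutation.Propositional.Properties
  using (All-resp-↭; Any-resp-↭)
open import Data.Vec using (Vec)
import Data.Vec as Vec
open import Data.Vec.Properties using (map-∘)
open import Function using (_∘_; case_of_)
open import Function.Bundles using (_⇔_; mk⇔; Equivalence; Injection)
open import Function.Definitions using (Injective)
open import Relation.Nullary using (¬_; yes; no)
open import Relation.Nullary.Decidable using (map′; dec-true; dec-false)
open import Relation.Unary using (Decidable)
open import Relation.Binary.PropositionalEquality
  using (_≡_; _≢_; refl; sym; cong; cong₂; subst; module ≡-Reasoning)

open Equivalence using (to; from)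

if-≡ᵇ-refl : ∀ {a} {A : Set a} y (b c : A) → (if y ≡ᵇ y then b else c) ≡ b
if-≡ᵇ-refl y b c = cong (λ β → if β then b else c) (dec-true (y ≟ y) refl)

if-≡ᵇ-≢ : ∀ {a} {A : Set a} {u y} (b c : A) → u ≢ y → (if u ≡ᵇ y then b else c) ≡ c
if-≡ᵇ-≢ {u = u} {y} b c u≢y = cong (λ β → if β then b else c) (dec-false (u ≟ y) u≢y)

lower-excluded-middle : ∀ {a b} → ExcludedMiddle (a ⊔ℓ b) → ExcludedMiddle a
lower-excluded-middle {b = b} em = map′ lower lift (em {Lift b _})

left-inverse : ∀ {a b} {A : Set a} {B : Set b} → ExcludedMiddle (a ⊔ℓ b) →
  A → (f : A → B) → Injective _≡_ _≡_ f → Σ (B → A) λ r → ∀ x → r (f x) ≡ x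
left-inverse {A = A} {B} em x₀ f f-inj = r , r∘f
  where
  r : B → A
  r y with em {Σ A λ x → f x ≡ y}
  ... | yes (x , _) = x
  ... | no _ = x₀
  r∘f : ∀ x → r (f x) ≡ x
  r∘f x with em {Σ A λ x′ → f x′ ≡ f x}
  ... | yes (x′ , fx′≡fx) = f-inj fx′≡fx
  ... | no ∄x′ = ⊥-elim (∄x′ (x , refl))

≤-foldr-⊔ : ∀ {a} {A : Set a} (f : A → ℕ) y {xs x} → x ∈ xs → f x ≤ foldr _⊔_ y (map f xs)
≤-foldr-⊔ f y {x ∷ xs} (here refl) = m≤m⊔n (f x) _
≤-foldr-⊔ f y {x ∷ xs} (there x∈xs) = ≤-trans (≤-foldr-⊔ f y x∈xs) (m≤n⊔m (f x) _)

map-cong-∈ : ∀ {a b} {A : Set a} {B : Set b} {m} {f g : A → B} (xs : Vec A m) →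
  (∀ {u} → u ∈ Vec.toList xs → f u ≡ g u) → Vec.map f xs ≡ Vec.map g xs
map-cong-∈ Vec.[] f≗g = refl
map-cong-∈ (x Vec.∷ xs) f≗g = cong₂ Vec._∷_ (f≗g (here refl)) (map-cong-∈ xs (f≗g ∘ there))

FV⊆vars : ∀ φ → FV φ ⊆ vars φ
FV⊆vars (atom p m xs) = λ u∈ → u∈
FV⊆vars ⊥' ()
FV⊆vars (φ ⇒' ψ) = ++⁺ (FV⊆vars φ) (FV⊆vars ψ)
FV⊆vars (φ ∧' ψ) = ++⁺ (FV⊆vars φ) (FV⊆vars ψ)
FV⊆vars (φ ⩒ ψ) = ++⁺ (FV⊆vars φ) (FV⊆vars ψ)
FV⊆vars (∀' x φ) = there ∘ FV⊆vars φ ∘ proj₁ ∘ ∈-filter⁻ _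
FV⊆vars (∃̄ x φ) = there ∘ FV⊆vars φ ∘ proj₁ ∘ ∈-filter⁻ _

free-≢-fresh : ∀ φ {u z} → u ∈ FV φ → z ∉ vars φ → u ≢ z
free-≢-fresh φ u∈ z∉ refl = z∉ (FV⊆vars φ u∈)

∈-FV-binder : ∀ {x φ u} → u ∈ FV φ → u ≢ x → u ∈ FV (∀' x φ)
∈-FV-binder = ∈-filter⁺ _

binder-avoids-capture : ∀ σ y φ {u} → u ∈ FV φ → u ≢ y → σ u ≢ binder σ y φ
binder-avoids-capture σ y φ {u} u∈ u≢y = avoids (any captured (FV φ)) refl
  where
  captured : Var → Bool
  captured v = not (v ≡ᵇ y) ∧ (σ v ≡ᵇ y)
  avoids : ∀ b → any captured (FV φ) ≡ b →
    σ u ≢ (if b then suc (foldr _⊔_ y (map σ (FV φ))) else y)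
  avoids true _ = <⇒≢ (s≤s (≤-foldr-⊔ σ y u∈))
  avoids false none σu≡y = subst T none (any⁺ captured (lose u∈ u-captured))
    where
    u-captured : T (captured u)
    u-captured = from T-∧ (from T-not-≡ (dec-false (u ≟ y) u≢y) , ≡⇒≡ᵇ (σ u) y σu≡y)

label-filter : ∀ {p} {P : ℕ → Set p} → Decidable P → (X : Label) →
  (∀ {k} → k ∈L X → ¬ P k) ⊎ Σ Label λ Y → ∀ k → k ∈L Y ⇔ (k ∈L X × P k)
label-filter P? X with filter P? (elems X) in eq
... | [] = inj₁ λ k∈ Pk → ¬Any[] (subst (_ ∈_) eq (∈-filter⁺ P? k∈ Pk))
... | k ∷ ks = inj₂ (Y , λ j → mk⇔ (∈-filter⁻ P? ∘ subst (j ∈_) (sym eq))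
                                   (λ (j∈X , Pj) → subst (j ∈_) eq (∈-filter⁺ P? j∈X Pj)))
  where
  Y : Label
  Y = mkLabel (k ∷ ks) (subst (AllPairs _<_) eq (AllPairs.filter⁺ P? (strict X))) (λ ())

module Semantics (M : Model) where
  open Model M

  infix 4 _⊩⟨_⟩_ _⊑_

  _⊩⟨_⟩_ : State M → (Var → D) → Formula → Set₁
  _⊩⟨_⟩_ = _⊩[_]_ M

  _⊑_ : State M → State M → Set
  _⊑_ = _⊆ₛ_ M

  _⟨_≔_⟩ : (Var → D) → Var → D → (Var → D)
  _⟨_≔_⟩ = _[_≔_] M

  ⊩-persistent : ∀ φ {s t g} → t ⊑ s → s ⊩⟨ g ⟩ φ → t ⊩⟨ g ⟩ φ
  ⊩-persistent (atom p m xs) t⊑s (lift sφ) = lift λ w tw → sφ w (t⊑s w tw)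
  ⊩-persistent ⊥' t⊑s (lift s∅) = lift λ w tw → s∅ w (t⊑s w tw)
  ⊩-persistent (φ ⇒' ψ) t⊑s sφ⇒ψ r r⊑t = sφ⇒ψ r λ w → t⊑s w ∘ r⊑t w
  ⊩-persistent (φ ∧' ψ) t⊑s (sφ , sψ) = ⊩-persistent φ t⊑s sφ , ⊩-persistent ψ t⊑s sψ
  ⊩-persistent (φ ⩒ ψ) t⊑s (inj₁ sφ) = inj₁ (⊩-persistent φ t⊑s sφ)
  ⊩-persistent (φ ⩒ ψ) t⊑s (inj₂ sψ) = inj₂ (⊩-persistent ψ t⊑s sψ)
  ⊩-persistent (∀' x φ) t⊑s sφ d = ⊩-persistent φ t⊑s (sφ d)
  ⊩-persistent (∃̄ x φ) t⊑s (d , sφ) = d , ⊩-persistent φ t⊑s sφ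

  ⊩-empty : ∀ φ {s g} → (∀ w → ¬ s w) → s ⊩⟨ g ⟩ φ
  ⊩-empty (atom p m xs) s∅ = lift λ w sw → ⊥-elim (s∅ w sw)
  ⊩-empty ⊥' s∅ = lift s∅
  ⊩-empty (φ ⇒' ψ) s∅ t t⊑s _ = ⊩-empty ψ λ w → s∅ w ∘ t⊑s w
  ⊩-empty (φ ∧' ψ) s∅ = ⊩-empty φ s∅ , ⊩-empty ψ s∅
  ⊩-empty (φ ⩒ ψ) s∅ = inj₁ (⊩-empty φ s∅)
  ⊩-empty (∀' x φ) s∅ d = ⊩-empty φ s∅
  ⊩-empty (∃̄ x φ) s∅ = d₀ , ⊩-empty φ s∅

  Renames : List Var → (Var → Var) → (Var → D) → (Var → D) → Set
  Renames xs σ g g′ = ∀ {u} → u ∈ xs → g′ u ≡ g (σ u)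

  Renames-binder : ∀ σ y φ {g g′} d → Renames (FV (∀' y φ)) σ g g′ →
    Renames (FV φ) (σ [ y ↦ binder σ y φ ]) (g ⟨ binder σ y φ ≔ d ⟩) (g′ ⟨ y ≔ d ⟩)
  Renames-binder σ y φ {g} {g′} d ρ {u} u∈ with u ≟ y
  ... | yes refl = begin
    (g′ ⟨ u ≔ d ⟩) u                 ≡⟨ if-≡ᵇ-refl u d (g′ u) ⟩
    d                                ≡⟨ if-≡ᵇ-refl b d (g b) ⟨
    (g ⟨ b ≔ d ⟩) b                  ≡⟨ cong (g ⟨ b ≔ d ⟩) (if-≡ᵇ-refl u b (σ u)) ⟨
    (g ⟨ b ≔ d ⟩) ((σ [ u ↦ b ]) u)  ∎
    where open ≡-Reasoning
          b = binder σ y φ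
  ... | no u≢y = begin
    (g′ ⟨ y ≔ d ⟩) u                 ≡⟨ if-≡ᵇ-≢ d (g′ u) u≢y ⟩
    g′ u                             ≡⟨ ρ (∈-FV-binder {φ = φ} u∈ u≢y) ⟩
    g (σ u)                          ≡⟨ if-≡ᵇ-≢ d (g (σ u)) (binder-avoids-capture σ y φ u∈ u≢y) ⟨
    (g ⟨ b ≔ d ⟩) (σ u)              ≡⟨ cong (g ⟨ b ≔ d ⟩) (if-≡ᵇ-≢ b (σ u) u≢y) ⟨
    (g ⟨ b ≔ d ⟩) ((σ [ y ↦ b ]) u)  ∎
    where open ≡-Reasoning
          b = binder σ y φ

  ⊩-rename : ∀ φ σ {s g g′} → Renames (FV φ) σ g g′ → s ⊩⟨ g ⟩ rename σ φ ⇔ s ⊩⟨ g′ ⟩ φ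
  ⊩-rename (atom p m xs) σ {g = g} ρ
    rewrite sym (map-∘ g σ xs) | map-cong-∈ xs (sym ∘ ρ) = mk⇔ (λ a → a) (λ a → a)
  ⊩-rename ⊥' σ ρ = mk⇔ (λ a → a) (λ a → a)
  ⊩-rename (φ ⇒' ψ) σ {g = g} {g′} ρ = mk⇔
    (λ sφ⇒ψ t t⊑s → to ihψ ∘ sφ⇒ψ t t⊑s ∘ from ihφ)
    (λ sφ⇒ψ t t⊑s → from ihψ ∘ sφ⇒ψ t t⊑s ∘ to ihφ)
    where
    ihφ : ∀ {t} → t ⊩⟨ g ⟩ rename σ φ ⇔ t ⊩⟨ g′ ⟩ φ
    ihφ = ⊩-rename φ σ (ρ ∘ ∈-++⁺ˡ)
    ihψ : ∀ {t} → t ⊩⟨ g ⟩ rename σ ψ ⇔ t ⊩⟨ g′ ⟩ ψ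
    ihψ = ⊩-rename ψ σ (ρ ∘ ∈-++⁺ʳ (FV φ))
  ⊩-rename (φ ∧' ψ) σ ρ =
    mk⇔ (Product.map (to ihφ) (to ihψ)) (Product.map (from ihφ) (from ihψ))
    where ihφ = ⊩-rename φ σ (ρ ∘ ∈-++⁺ˡ)
          ihψ = ⊩-rename ψ σ (ρ ∘ ∈-++⁺ʳ (FV φ))
  ⊩-rename (φ ⩒ ψ) σ ρ =
    mk⇔ (Sum.map (to ihφ) (to ihψ)) (Sum.map (from ihφ) (from ihψ))
    where ihφ = ⊩-rename φ σ (ρ ∘ ∈-++⁺ˡ)
          ihψ = ⊩-rename ψ σ (ρ ∘ ∈-++⁺ʳ (FV φ))
  ⊩-rename (∀' y φ) σ {g = g} {g′} ρ =
    mk⇔ (λ sφ d → to (ih d) (sφ d)) (λ sφ d → from (ih d) (sφ d))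
    where ih = λ d → ⊩-rename φ (σ [ y ↦ binder σ y φ ]) (Renames-binder σ y φ {g} {g′} d ρ)
  ⊩-rename (∃̄ y φ) σ {g = g} {g′} ρ =
    mk⇔ (λ (d , sφ) → d , to (ih d) sφ) (λ (d , sφ) → d , from (ih d) sφ)
    where ih = λ d → ⊩-rename φ (σ [ y ↦ binder σ y φ ]) (Renames-binder σ y φ {g} {g′} d ρ)

  ⊩-coincide : ∀ φ {s g g′} → (∀ {u} → u ∈ FV φ → g u ≡ g′ u) → s ⊩⟨ g ⟩ φ → s ⊩⟨ g′ ⟩ φ
  ⊩-coincide φ g≗g′ =
    to (⊩-rename φ (λ u → u) (sym ∘ g≗g′)) ∘ from (⊩-rename φ (λ u → u) (λ _ → refl))

  ⊩-update-fresh : ∀ φ {s g z} d → z ∉ vars φ → s ⊩⟨ g ⟩ φ ⇔ s ⊩⟨ g ⟨ z ≔ d ⟩ ⟩ φ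
  ⊩-update-fresh φ {g = g} {z} d z∉φ =
    mk⇔ (⊩-coincide φ unchanged) (⊩-coincide φ (sym ∘ unchanged))
    where
    unchanged : ∀ {u} → u ∈ FV φ → g u ≡ (g ⟨ z ≔ d ⟩) u
    unchanged {u} u∈ = sym (if-≡ᵇ-≢ d (g u) (free-≢-fresh φ u∈ z∉φ))

  ⊩-subst : ∀ φ x y {s g} → s ⊩⟨ g ⟩ φ [ y / x ] ⇔ s ⊩⟨ g ⟨ x ≔ g y ⟩ ⟩ φ
  ⊩-subst φ x y {g = g} = ⊩-rename φ ((λ u → u) [ x ↦ y ]) λ {u} _ → sym (if-float g (u ≡ᵇ x))

  ⊩-subst-fresh : ∀ φ x {z s g} d → z ∉ vars φ →
    s ⊩⟨ g ⟨ z ≔ d ⟩ ⟩ φ [ z / x ] ⇔ s ⊩⟨ g ⟨ x ≔ d ⟩ ⟩ φ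
  ⊩-subst-fresh φ x {z} {g = g} d z∉φ = ⊩-rename φ ((λ u → u) [ x ↦ z ]) renames
    where
    renames : Renames (FV φ) ((λ u → u) [ x ↦ z ]) (g ⟨ z ≔ d ⟩) (g ⟨ x ≔ d ⟩)
    renames {u} u∈ = begin
      (g ⟨ x ≔ d ⟩) u
        ≡⟨ if-cong₂ (u ≡ᵇ x) (if-≡ᵇ-refl z d (g z)) (if-≡ᵇ-≢ d (g u) (free-≢-fresh φ u∈ z∉φ)) ⟨
      (if u ≡ᵇ x then (g ⟨ z ≔ d ⟩) z else (g ⟨ z ≔ d ⟩) u)
        ≡⟨ if-float (g ⟨ z ≔ d ⟩) (u ≡ᵇ x) ⟨
      (g ⟨ z ≔ d ⟩) (((λ u → u) [ x ↦ z ]) u)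
        ∎
      where open ≡-Reasoning

module Soundness (M : Model) (em : ExcludedMiddle (lsuc 0ℓ)) (h : ℕ → Model.W M) where
  open Model M
  open Semantics M

  em₀ : ExcludedMiddle 0ℓ
  em₀ = lower-excluded-middle {b = lsuc 0ℓ} em

  ⟦_⟧ : Label → State M
  ⟦ X ⟧ w = Σ ℕ λ k → k ∈L X × h k ≡ w

  Holds : (Var → D) → LFormula → Set₁
  Holds g (X , φ) = ⟦ X ⟧ ⊩⟨ g ⟩ φ

  ⟦⟧-mono : ∀ X Y → Y ⊆L X → ⟦ Y ⟧ ⊑ ⟦ X ⟧
  ⟦⟧-mono X Y Y⊆X w (k , k∈Y , hk≡w) = k , Y⊆X k∈Y , hk≡w

  ⟦⟧-nonempty : ∀ X → Σ W ⟦ X ⟧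
  ⟦⟧-nonempty (mkLabel [] _ nonempty) = ⊥-elim (nonempty refl)
  ⟦⟧-nonempty (mkLabel (k ∷ _) _ _) = h k , k , here refl , refl

  ⊩-atom-pointwise : ∀ X {p m xs g} →
    (∀ k → k ∈L X → ⟦ singleton k ⟧ ⊩⟨ g ⟩ atom p m xs) → ⟦ X ⟧ ⊩⟨ g ⟩ atom p m xs
  ⊩-atom-pointwise X sk =
    lift λ { w (k , k∈X , hk≡w) → lower (sk k k∈X) w (k , here refl , hk≡w) }

  substate-label : ∀ X t → t ⊑ ⟦ X ⟧ →
    (∀ w → ¬ t w) ⊎ Σ Label λ Y → Y ⊆L X × t ⊑ ⟦ Y ⟧ × ⟦ Y ⟧ ⊑ t
  substate-label X t t⊑X with label-filter (λ k → em₀ {t (h k)}) X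
  ... | inj₁ none = inj₁ λ w tw → case t⊑X w tw of λ { (k , k∈X , refl) → none k∈X tw }
  ... | inj₂ (Y , Y≐X∩t) = inj₂ (Y , proj₁ ∘ to (Y≐X∩t _) , t⊑Y , Y⊑t)
    where
    t⊑Y : t ⊑ ⟦ Y ⟧
    t⊑Y w tw with t⊑X w tw
    ... | k , k∈X , refl = k , from (Y≐X∩t k) (k∈X , tw) , refl
    Y⊑t : ⟦ Y ⟧ ⊑ t
    Y⊑t w (k , k∈Y , refl) = proj₂ (to (Y≐X∩t k) k∈Y)

  ⊩-⇒-from-labels : ∀ X {φ ψ g} →
    (∀ Y → Y ⊆L X → ⟦ Y ⟧ ⊩⟨ g ⟩ φ → ⟦ Y ⟧ ⊩⟨ g ⟩ ψ) → ⟦ X ⟧ ⊩⟨ g ⟩ φ ⇒' ψ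
  ⊩-⇒-from-labels X {φ} {ψ} step t t⊑X tφ with substate-label X t t⊑X
  ... | inj₁ t-empty = ⊩-empty ψ t-empty
  ... | inj₂ (Y , Y⊆X , t⊑Y , Y⊑t) = ⊩-persistent ψ t⊑Y (step Y Y⊆X (⊩-persistent φ Y⊑t tφ))

  All-update-fresh : ∀ {Γ g z} d → z ∉ lvars Γ → All (Holds g) Γ → All (Holds (g ⟨ z ≔ d ⟩)) Γ
  All-update-fresh d z∉ [] = []
  All-update-fresh {(X , φ) ∷ Γ} d z∉ (sφ ∷ γ) =
    to (⊩-update-fresh φ d (z∉ ∘ ∈-++⁺ˡ)) sφ ∷ All-update-fresh d (z∉ ∘ ∈-++⁺ʳ (vars φ)) γ

  Any-update-fresh⁻ : ∀ {Δ g z} d → z ∉ lvars Δ → Any (Holds (g ⟨ z ≔ d ⟩)) Δ → Any (Holds g) Δ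
  Any-update-fresh⁻ {(X , φ) ∷ Δ} d z∉ (here sφ) =
    here (from (⊩-update-fresh φ d (z∉ ∘ ∈-++⁺ˡ)) sφ)
  Any-update-fresh⁻ {(X , φ) ∷ Δ} d z∉ (there δ) =
    there (Any-update-fresh⁻ d (z∉ ∘ ∈-++⁺ʳ (vars φ)) δ)

  -- A premise quantified over k, Y or d gives, for each instance, the principal
  -- formula or Δ; excluded middle on Δ is what combines the instances.
  classically-here : ∀ {g A Δ} → (¬ Any (Holds g) Δ → Holds g A) → Any (Holds g) (A ∷ Δ)
  classically-here {g} {Δ = Δ} from-¬Δ with em {Any (Holds g) Δ}
  ... | yes δ = there δ
  ... | no ¬δ = here (from-¬Δ ¬δ)

  sound : ∀ {Γ Δ} → Γ ⟹ Δ → ∀ g → All (Holds g) Γ → Any (Holds g) Δ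
  sound (perm Γ↭ Δ↭ d) g γ = Any-resp-↭ Δ↭ (sound d g (All-resp-↭ (↭-sym Γ↭) γ))
  sound (id {X} {Y} Y⊆X) g (sP ∷ _) = here (⊩-persistent (atom _ _ _) (⟦⟧-mono X Y Y⊆X) sP)
  sound (⊥⇒ {X}) g (lift s∅ ∷ _) = ⊥-elim (s∅ _ (proj₂ (⟦⟧-nonempty X)))
  sound (⇒at {X} premise) g γ = classically-here λ ¬δ →
    ⊩-atom-pointwise X λ k k∈X → Any.head ¬δ (sound (premise k k∈X) g γ)
  sound (⇒∧ d₁ d₂) g γ with sound d₁ g γ | sound d₂ g γ
  ... | here sφ | here sψ = here (sφ , sψ)
  ... | here _  | there δ = there δ
  ... | there δ | _       = there δ
  sound (∧⇒ d) g ((sφ , sψ) ∷ γ) = sound d g (sφ ∷ sψ ∷ γ)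
  sound (⇒⩒ d) g γ with sound d g γ
  ... | here sφ = here (inj₁ sφ)
  ... | there (here sψ) = here (inj₂ sψ)
  ... | there (there δ) = there δ
  sound (⩒⇒ d₁ d₂) g (inj₁ sφ ∷ γ) = sound d₁ g (sφ ∷ γ)
  sound (⩒⇒ d₁ d₂) g (inj₂ sψ ∷ γ) = sound d₂ g (sψ ∷ γ)
  sound (⇒→ {X} premise) g γ = classically-here λ ¬δ →
    ⊩-⇒-from-labels X λ Y Y⊆X sφ → Any.head ¬δ (sound (premise Y Y⊆X) g (sφ ∷ γ))
  sound (→⇒ {X} {Y} Y⊆X d₁ d₂) g (sφ⇒ψ ∷ γ) with sound d₁ g (sφ⇒ψ ∷ γ)
  ... | here sφ = sound d₂ g (sφ⇒ψ ⟦ Y ⟧ (⟦⟧-mono X Y Y⊆X) sφ ∷ sφ⇒ψ ∷ γ)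
  ... | there δ = δ
  sound (⇒∀ {x = x} {z} {φ} z∉Γ z∉Δ d) g γ = classically-here λ ¬δ e →
    to (⊩-subst-fresh φ x e (z∉Δ ∘ ∈-++⁺ˡ ∘ there))
       (Any.head (¬δ ∘ Any-update-fresh⁻ e (z∉Δ ∘ ∈-++⁺ʳ (x ∷ vars φ)))
                 (sound d (g ⟨ z ≔ e ⟩) (All-update-fresh e z∉Γ γ)))
  sound (∀⇒ {x = x} {y} {φ} d) g (s∀ ∷ γ) =
    sound d g (from (⊩-subst φ x y) (s∀ (g y)) ∷ s∀ ∷ γ)
  sound (⇒∃̄ {x = x} {y} {φ} d) g γ with sound d g γ
  ... | here s∃ = here s∃
  ... | there (here sφ) = here (g y , to (⊩-subst φ x y) sφ)
  ... | there (there δ) = there δ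
  sound (∃̄⇒ {x = x} {z} {φ} z∉Γ z∉Δ d) g ((e , sφ) ∷ γ) =
    Any-update-fresh⁻ e z∉Δ
      (sound d (g ⟨ z ≔ e ⟩) (from (⊩-subst-fresh φ x e (z∉Γ ∘ ∈-++⁺ˡ ∘ there)) sφ
                              ∷ All-update-fresh e (z∉Γ ∘ ∈-++⁺ʳ (x ∷ vars φ)) γ))

  supported-if-covering : ∀ {X φ} → [] ⟹ (X ∶ φ) ∷ [] → (∀ w → ⟦ X ⟧ w) →
    ∀ s g → s ⊩⟨ g ⟩ φ
  supported-if-covering {φ = φ} d covering s g =
    ⊩-persistent φ (λ w _ → covering w) (Any.head ¬Any[] (sound d g []))

corollary2 : ExcludedMiddle (lsuc 0ℓ) →
    ∀ (n : ℕ) → 1 ≤ n → (φ : Formula) (X : Label) →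
    (∀ k → (k ∈L X) ⇔ (1 ≤ k × k ≤ n)) →
    [] ⟹ (X ∶ φ) ∷ [] →
    InqBQ n φ
corollary2 em n _ φ X X≐[1,n] d M W↣Fin = supported-if-covering d covering
  where
  open Model M
  ι : W → Fin n
  ι = Injection.to W↣Fin
  index : W → ℕ
  index w = suc (toℕ (ι w))
  enumeration : Σ (ℕ → W) λ h → ∀ w → h (index w) ≡ w
  enumeration = left-inverse (lower-excluded-middle {b = lsuc 0ℓ} em) w₀ index
    (Injection.injective W↣Fin ∘ toℕ-injective ∘ suc-injective)
  open Soundness M em (proj₁ enumeration)
  covering : ∀ w → ⟦ X ⟧ w
  covering w = index w , from (X≐[1,n] (index w)) (s≤s z≤n , toℕ<n (ι w)) , proj₂ enumeration w
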